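{- Let $m\ge2$ and $i_1,\dots,i_N\in\{0,1\}$, and suppose \[\tilde T_{i_N}\circ\cdots\circ\tilde T_{i_1}\big((n_1,\dots,n_m)\times[k_1,\dots,k_m]\big)=(\bar n_1,\dots,\bar n_m)\times[\bar k_1,\dots,\bar k_m].\] Then \[\tilde T_{i_1}\circ\cdots\circ\tilde T_{i_N}\big((\bar k_1+\cdots+\bar k_m,\dots,\bar k_1)\times[\bar n_m,\bar n_{m-1}-\bar n_m,\dots,\bar n_1-\bar n_2]\big)=(k_1+\cdots+k_m,\dots,k_1)\times[n_m,n_{m-1}-n_m,\dots,n_1-n_2].\]
   Context: $(n_1,\dots,n_m)\times[k_1,\dots,k_m]$ denotes the partition with $k_i$ parts $n_i$; its conjugate is $(k_1+\cdots+k_m,k_1+\cdots+k_{m-1},\dots,k_1)\times[n_m,n_{m-1}-n_m,\dots,n_1-n_2]$. The extended slow-Triangle maps are $\tilde T_0((n_1,\dots,n_m)\times[k_1,\dots,k_m])=(n_2,\dots,n_m,n_1-n_2)\times[k_1+k_2,k_3,\dots,k_m,k_1]$ (applicable when $n_2+n_m>n_1$) and $\tilde T_1((n_1,\dots,n_m)\times[k_1,\dots,k_m])=(n_1-n_m,n_2,\dots,n_m)\times[k_1,\dots,k_{m-1},k_1+k_m]$ (applicable when $n_2+n_m<n_1$). -}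

module Defs where

open import Data.Nat using (ℕ; zero; suc; _+_; _∸_; _<_; _<?_)
open import Data.Nat.Properties using ()
open import Data.Fin using (Fin; zero; suc)
open import Data.Vec using (Vec; []; _∷_; _∷ʳ_; map; reverse; init; last)
open import Data.Vec.Relation.Unary.All using (All)
open import Data.List using (List)
import Data.List as L
open import Data.Maybe using (Maybe; just; nothing; _>>=_)
open import Data.Product using (_×_; _,_)
open import Data.Unit using (⊤)
open import Relation.Nullary using (yes; no)

-- A partition (n_1,...,n_m) × [k_1,...,k_m] : k_i parts equal to n_i,
-- represented by the pair of vectors (n , k).
Part : ℕ → Set
Part m = Vec ℕ m × Vec ℕ m

StrictDecPos : ∀ {m} → Vec ℕ m → Set
StrictDecPos [] = ⊤
StrictDecPos (x ∷ []) = 0 < x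
StrictDecPos (x ∷ y ∷ r) = (y < x) × StrictDecPos (y ∷ r)

IsPartition : ∀ {m} → Part m → Set
IsPartition (n , k) = StrictDecPos n × All (0 <_) k

psum : ∀ {m} → Vec ℕ m → Vec ℕ m
psum [] = []
psum (x ∷ r) = x ∷ map (x +_) (psum r)

diffs : ∀ {m} → Vec ℕ m → Vec ℕ m
diffs [] = []
diffs (x ∷ []) = x ∷ []
diffs (x ∷ y ∷ r) = (x ∸ y) ∷ diffs (y ∷ r)

conj : ∀ {m} → Part m → Part m
conj (n , k) = reverse (psum k) , reverse (diffs n)

T0 : ∀ {m} → Part (suc (suc m)) → Maybe (Part (suc (suc m)))
T0 (n1 ∷ n2 ∷ ns , k1 ∷ k2 ∷ ks) with n1 <? n2 + last (n1 ∷ n2 ∷ ns)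
... | yes _ = just ((n2 ∷ ns) ∷ʳ (n1 ∸ n2) , (k1 + k2) ∷ (ks ∷ʳ k1))
... | no _ = nothing

T1 : ∀ {m} → Part (suc (suc m)) → Maybe (Part (suc (suc m)))
T1 (n1 ∷ n2 ∷ ns , k) with n2 + last (n1 ∷ n2 ∷ ns) <? n1
... | yes _ = just ((n1 ∸ last (n1 ∷ n2 ∷ ns)) ∷ n2 ∷ ns ,
                    init k ∷ʳ (Data.Vec.head k + last k))
... | no _ = nothing

Tt : ∀ {m} → Fin 2 → Part (suc (suc m)) → Maybe (Part (suc (suc m)))
Tt zero = T0
Tt (suc zero) = T1

run : ∀ {m} → List (Fin 2) → Part (suc (suc m)) → Maybe (Part (suc (suc m)))
run L.[] p = just p
run (i L.∷ is) p = Tt i p >>= run is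

-- Everything reduces to a single step: if T̃ᵢ p = q then T̃ᵢ (conj q) = conj p,
-- after which induction along the word i₁ … i_N reverses the composition.
-- The single step is a computation with prefix sums and consecutive
-- differences; T̃ᵢ applies to conj q because the multiplicities are positive
-- (T̃₀ needs k₂ > 0, T̃₁ needs k_m > 0), and T̃ᵢ preserves that positivity.
module Submission where

open import Defs
open import Data.Nat using (ℕ; suc; _+_; _∸_; _<_; _≤_; _<?_)
open import Data.Nat.Properties
  using (≤-trans; <⇒≤; m≤n+m; m≤m+n; m<m+n; +-monoʳ-<; +-assoc; +-comm; m+n∸m≡n; +-∸-assoc;
         m+[n∸m]≡n; m≤n+o⇒m∸n≤o; m+n≤o⇒m≤o∸n; ∸-+-assoc)
open import Data.Fin using (Fin; zero; suc)
open import Data.Vec using (Vec; []; _∷_; _∷ʳ_; init; last; head; map; reverse)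
open import Data.Vec.Properties using (reverse-∷; init-∷ʳ; last-∷ʳ; last-reverse; map-∷ʳ; map-∘; map-cong)
open import Data.Vec.Relation.Unary.All using (All; []; _∷_)
open import Data.List using (List; [_]; _++_)
import Data.List as List
open import Data.List.Properties using (unfold-reverse)
open import Data.Maybe using (just; nothing; _>>=_)
open import Data.Product using (_×_; _,_; proj₂)
open import Relation.Binary.PropositionalEquality
  using (_≡_; refl; sym; trans; cong; cong₂; subst; module ≡-Reasoning)
open import Relation.Nullary using (yes; no)
open import Relation.Nullary.Negation using (contradiction)

private
  variable
    A : Set
    j m : ℕ

reverse-∷ʳ : (xs : Vec A j) (x : A) → reverse (xs ∷ʳ x) ≡ x ∷ reverse xs
reverse-∷ʳ [] x = refl
reverse-∷ʳ (y ∷ xs) x = begin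
  reverse (y ∷ (xs ∷ʳ x))  ≡⟨ reverse-∷ y (xs ∷ʳ x) ⟩
  reverse (xs ∷ʳ x) ∷ʳ y   ≡⟨ cong (_∷ʳ y) (reverse-∷ʳ xs x) ⟩
  x ∷ (reverse xs ∷ʳ y)    ≡⟨ cong (x ∷_) (reverse-∷ y xs) ⟨
  x ∷ reverse (y ∷ xs)     ∎
  where open ≡-Reasoning

init-∷ʳ-last : (v : Vec A (suc j)) → init v ∷ʳ last v ≡ v
init-∷ʳ-last (x ∷ []) = refl
init-∷ʳ-last (x ∷ y ∷ v) = cong (x ∷_) (init-∷ʳ-last (y ∷ v))

reverse-last-∷ : (v : Vec A (suc j)) → reverse v ≡ last v ∷ reverse (init v)
reverse-last-∷ v = trans (cong reverse (sym (init-∷ʳ-last v))) (reverse-∷ʳ (init v) (last v))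

last-map : (f : A → A) (v : Vec A (suc j)) → last (map f v) ≡ f (last v)
last-map f (x ∷ []) = refl
last-map f (x ∷ y ∷ v) = last-map f (y ∷ v)

module _ {P : A → Set} where

  All-∷ʳ : {xs : Vec A j} {x : A} → All P xs → P x → All P (xs ∷ʳ x)
  All-∷ʳ [] px = px ∷ []
  All-∷ʳ (p ∷ ps) px = p ∷ All-∷ʳ ps px

  All-init : {xs : Vec A (suc j)} → All P xs → All P (init xs)
  All-init {xs = _ ∷ []} _ = []
  All-init {xs = _ ∷ _ ∷ _} (p ∷ ps) = p ∷ All-init ps

  All-last : {xs : Vec A (suc j)} → All P xs → P (last xs)
  All-last {xs = _ ∷ []} (p ∷ _) = p
  All-last {xs = _ ∷ _ ∷ _} (_ ∷ ps) = All-last ps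

psum-∷ʳ : (xs : Vec ℕ (suc j)) (c : ℕ) → psum (xs ∷ʳ c) ≡ psum xs ∷ʳ (last (psum xs) + c)
psum-∷ʳ (x ∷ []) c = refl
psum-∷ʳ (x ∷ y ∷ r) c = cong (x ∷_) (begin
  map (x +_) (psum ((y ∷ r) ∷ʳ c))
    ≡⟨ cong (map (x +_)) (psum-∷ʳ (y ∷ r) c) ⟩
  map (x +_) (psum (y ∷ r) ∷ʳ (last (psum (y ∷ r)) + c))
    ≡⟨ map-∷ʳ (x +_) _ (psum (y ∷ r)) ⟩
  map (x +_) (psum (y ∷ r)) ∷ʳ (x + (last (psum (y ∷ r)) + c))
    ≡⟨ cong (map (x +_) (psum (y ∷ r)) ∷ʳ_) (sym (+-assoc x _ c)) ⟩
  map (x +_) (psum (y ∷ r)) ∷ʳ (x + last (psum (y ∷ r)) + c)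
    ≡⟨ cong (λ z → map (x +_) (psum (y ∷ r)) ∷ʳ (z + c)) (sym (last-map (x +_) (psum (y ∷ r)))) ⟩
  map (x +_) (psum (y ∷ r)) ∷ʳ (last (map (x +_) (psum (y ∷ r))) + c) ∎)
  where open ≡-Reasoning

psum-merge : (a b : ℕ) (r : Vec ℕ j) → psum (a ∷ b ∷ r) ≡ a ∷ psum ((a + b) ∷ r)
psum-merge a b r = cong (λ z → a ∷ (a + b) ∷ z)
  (trans (sym (map-∘ (a +_) (b +_) (psum r))) (map-cong (λ z → sym (+-assoc a b z)) (psum r)))

last-diffs : (v : Vec ℕ (suc j)) → last (diffs v) ≡ last v
last-diffs (x ∷ []) = refl
last-diffs (x ∷ y ∷ v) = last-diffs (y ∷ v)

diffs-∷ʳ : (v : Vec ℕ (suc j)) (c : ℕ) → diffs (v ∷ʳ c) ≡ (init (diffs v) ∷ʳ (last v ∸ c)) ∷ʳ c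
diffs-∷ʳ (x ∷ []) c = refl
diffs-∷ʳ (x ∷ y ∷ v) c = cong ((x ∸ y) ∷_) (diffs-∷ʳ (y ∷ v) c)

-- The two components of conj, with enough constructors exposed for T0 and T1
-- to compute on them.

reverse-psum-∷ʳ : (xs : Vec ℕ (suc j)) (c : ℕ) →
  reverse (psum (xs ∷ʳ c)) ≡ (last (psum xs) + c) ∷ last (psum xs) ∷ reverse (init (psum xs))
reverse-psum-∷ʳ xs c = begin
  reverse (psum (xs ∷ʳ c))                       ≡⟨ cong reverse (psum-∷ʳ xs c) ⟩
  reverse (psum xs ∷ʳ (last (psum xs) + c))      ≡⟨ reverse-∷ʳ (psum xs) (last (psum xs) + c) ⟩
  (last (psum xs) + c) ∷ reverse (psum xs)       ≡⟨ cong ((last (psum xs) + c) ∷_) (reverse-last-∷ (psum xs)) ⟩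
  (last (psum xs) + c) ∷ last (psum xs) ∷ reverse (init (psum xs)) ∎
  where open ≡-Reasoning

reverse-psum-merge : (a b : ℕ) (r : Vec ℕ j) →
  reverse (psum (a ∷ b ∷ r)) ≡ (last (psum ((a + b) ∷ r)) ∷ reverse (init (psum ((a + b) ∷ r)))) ∷ʳ a
reverse-psum-merge a b r = begin
  reverse (psum (a ∷ b ∷ r))         ≡⟨ cong reverse (psum-merge a b r) ⟩
  reverse (a ∷ psum ((a + b) ∷ r))   ≡⟨ reverse-∷ a (psum ((a + b) ∷ r)) ⟩
  reverse (psum ((a + b) ∷ r)) ∷ʳ a  ≡⟨ cong (_∷ʳ a) (reverse-last-∷ (psum ((a + b) ∷ r))) ⟩
  (last (psum ((a + b) ∷ r)) ∷ reverse (init (psum ((a + b) ∷ r)))) ∷ʳ a ∎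
  where open ≡-Reasoning

last-reverse-init-psum : (xs : Vec ℕ (suc j)) →
  last (last (psum xs) ∷ reverse (init (psum xs))) ≡ head xs
last-reverse-init-psum xs@(_ ∷ _) =
  trans (cong last (sym (reverse-last-∷ (psum xs)))) (last-reverse (psum xs))

reverse-diffs-∷ : (x : ℕ) (v : Vec ℕ (suc j)) →
  reverse (diffs (x ∷ v)) ≡ (last v ∷ reverse (init (diffs v))) ∷ʳ (x ∸ head v)
reverse-diffs-∷ x v@(y ∷ _) = begin
  reverse ((x ∸ y) ∷ diffs v)     ≡⟨ reverse-∷ (x ∸ y) (diffs v) ⟩
  reverse (diffs v) ∷ʳ (x ∸ y)    ≡⟨ cong (_∷ʳ (x ∸ y)) (reverse-last-∷ (diffs v)) ⟩
  (last (diffs v) ∷ reverse (init (diffs v))) ∷ʳ (x ∸ y)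
    ≡⟨ cong (λ z → (z ∷ reverse (init (diffs v))) ∷ʳ (x ∸ y)) (last-diffs v) ⟩
  (last v ∷ reverse (init (diffs v))) ∷ʳ (x ∸ y) ∎
  where open ≡-Reasoning

reverse-diffs-∷ʳ : (v : Vec ℕ (suc j)) (c : ℕ) →
  reverse (diffs (v ∷ʳ c)) ≡ c ∷ (last v ∸ c) ∷ reverse (init (diffs v))
reverse-diffs-∷ʳ v c = begin
  reverse (diffs (v ∷ʳ c))                               ≡⟨ cong reverse (diffs-∷ʳ v c) ⟩
  reverse ((init (diffs v) ∷ʳ (last v ∸ c)) ∷ʳ c)        ≡⟨ reverse-∷ʳ (init (diffs v) ∷ʳ (last v ∸ c)) c ⟩
  c ∷ reverse (init (diffs v) ∷ʳ (last v ∸ c))           ≡⟨ cong (c ∷_) (reverse-∷ʳ (init (diffs v)) (last v ∸ c)) ⟩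
  c ∷ (last v ∸ c) ∷ reverse (init (diffs v))            ∎
  where open ≡-Reasoning

module _ (n₁ n₂ : ℕ) (ns : Vec ℕ m) where

  T0-applies : (k₁ k₂ : ℕ) (ks : Vec ℕ m) → n₁ < n₂ + last (n₁ ∷ n₂ ∷ ns) →
    T0 (n₁ ∷ n₂ ∷ ns , k₁ ∷ k₂ ∷ ks) ≡ just ((n₂ ∷ ns) ∷ʳ (n₁ ∸ n₂) , (k₁ + k₂) ∷ (ks ∷ʳ k₁))
  T0-applies k₁ k₂ ks applicable with n₁ <? n₂ + last (n₁ ∷ n₂ ∷ ns)
  ... | yes _ = refl
  ... | no ¬applicable = contradiction applicable ¬applicable

  T0-just : (k₁ k₂ : ℕ) (ks : Vec ℕ m) {q : Part (suc (suc m))} →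
    T0 (n₁ ∷ n₂ ∷ ns , k₁ ∷ k₂ ∷ ks) ≡ just q →
    n₁ < n₂ + last (n₁ ∷ n₂ ∷ ns) × ((n₂ ∷ ns) ∷ʳ (n₁ ∸ n₂) , (k₁ + k₂) ∷ (ks ∷ʳ k₁)) ≡ q
  T0-just k₁ k₂ ks eq with n₁ <? n₂ + last (n₁ ∷ n₂ ∷ ns)
  T0-just k₁ k₂ ks refl | yes applicable = applicable , refl

  T1-applies : (k : Vec ℕ (suc (suc m))) → n₂ + last (n₁ ∷ n₂ ∷ ns) < n₁ →
    T1 (n₁ ∷ n₂ ∷ ns , k) ≡ just ((n₁ ∸ last (n₁ ∷ n₂ ∷ ns)) ∷ n₂ ∷ ns , init k ∷ʳ (head k + last k))
  T1-applies k applicable with n₂ + last (n₁ ∷ n₂ ∷ ns) <? n₁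
  ... | yes _ = refl
  ... | no ¬applicable = contradiction applicable ¬applicable

  T1-just : (k : Vec ℕ (suc (suc m))) {q : Part (suc (suc m))} →
    T1 (n₁ ∷ n₂ ∷ ns , k) ≡ just q →
    n₂ + last (n₁ ∷ n₂ ∷ ns) < n₁ ×
    ((n₁ ∸ last (n₁ ∷ n₂ ∷ ns)) ∷ n₂ ∷ ns , init k ∷ʳ (head k + last k)) ≡ q
  T1-just k eq with n₂ + last (n₁ ∷ n₂ ∷ ns) <? n₁
  T1-just k refl | yes applicable = applicable , refl

module _ (n₁ n₂ : ℕ) (ns : Vec ℕ m) where

  T0-conj : (k₁ k₂ : ℕ) (ks : Vec ℕ m) → n₁ < n₂ + last (n₁ ∷ n₂ ∷ ns) → 0 < k₂ →
    T0 (conj ((n₂ ∷ ns) ∷ʳ (n₁ ∸ n₂) , (k₁ + k₂) ∷ (ks ∷ʳ k₁)))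
      ≡ just (conj (n₁ ∷ n₂ ∷ ns , k₁ ∷ k₂ ∷ ks))
  T0-conj k₁ k₂ ks applicable k₂>0 = begin
    T0 (conj ((n₂ ∷ ns) ∷ʳ d , (k₁ + k₂) ∷ (ks ∷ʳ k₁)))
      ≡⟨ cong T0 (cong₂ _,_ (reverse-psum-∷ʳ ((k₁ + k₂) ∷ ks) k₁) (reverse-diffs-∷ʳ (n₂ ∷ ns) d)) ⟩
    T0 ((X + k₁) ∷ X ∷ R , d ∷ (l ∸ d) ∷ D)
      ≡⟨ T0-applies (X + k₁) X R d (l ∸ d) D applicable′ ⟩
    just ((X ∷ R) ∷ʳ (X + k₁ ∸ X) , (d + (l ∸ d)) ∷ (D ∷ʳ d))
      ≡⟨ cong₂ (λ a b → just ((X ∷ R) ∷ʳ a , b ∷ (D ∷ʳ d))) (m+n∸m≡n X k₁) (m+[n∸m]≡n d≤l) ⟩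
    just ((X ∷ R) ∷ʳ k₁ , (l ∷ D) ∷ʳ d)
      ≡⟨ cong just (cong₂ _,_ (reverse-psum-merge k₁ k₂ ks) (reverse-diffs-∷ n₁ (n₂ ∷ ns))) ⟨
    just (conj (n₁ ∷ n₂ ∷ ns , k₁ ∷ k₂ ∷ ks)) ∎
    where
    open ≡-Reasoning
    X = last (psum ((k₁ + k₂) ∷ ks))
    R = reverse (init (psum ((k₁ + k₂) ∷ ks)))
    l = last (n₂ ∷ ns)
    d = n₁ ∸ n₂
    D = reverse (init (diffs (n₂ ∷ ns)))
    d≤l : d ≤ l
    d≤l = m≤n+o⇒m∸n≤o n₁ n₂ (<⇒≤ applicable)
    applicable′ : X + k₁ < X + last (X ∷ R)
    applicable′ = subst (λ z → X + k₁ < X + z) (sym (last-reverse-init-psum ((k₁ + k₂) ∷ ks)))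
                        (+-monoʳ-< X (m<m+n k₁ k₂>0))

  T1-conj : (k : Vec ℕ (suc (suc m))) → n₂ + last (n₁ ∷ n₂ ∷ ns) < n₁ → 0 < last k →
    T1 (conj ((n₁ ∸ last (n₁ ∷ n₂ ∷ ns)) ∷ n₂ ∷ ns , init k ∷ʳ (head k + last k)))
      ≡ just (conj (n₁ ∷ n₂ ∷ ns , k))
  T1-conj k@(k₁ ∷ _ ∷ _) applicable kₘ>0 = begin
    T1 (conj ((n₁ ∸ l) ∷ n₂ ∷ ns , init k ∷ʳ (k₁ + kₘ)))
      ≡⟨ cong T1 (cong₂ _,_ (reverse-psum-∷ʳ (init k) (k₁ + kₘ)) (reverse-diffs-∷ (n₁ ∸ l) (n₂ ∷ ns))) ⟩
    T1 ((S + (k₁ + kₘ)) ∷ S ∷ R , (l ∷ D) ∷ʳ e)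
      ≡⟨ T1-applies (S + (k₁ + kₘ)) S R ((l ∷ D) ∷ʳ e) applicable′ ⟩
    just ((S + (k₁ + kₘ) ∸ last (S ∷ R)) ∷ S ∷ R , init ((l ∷ D) ∷ʳ e) ∷ʳ (l + last ((l ∷ D) ∷ʳ e)))
      ≡⟨ cong₂ (λ a b → just ((S + (k₁ + kₘ) ∸ a) ∷ S ∷ R , b ∷ʳ (l + last ((l ∷ D) ∷ʳ e))))
               (last-reverse-init-psum (init k)) (init-∷ʳ e (l ∷ D)) ⟩
    just ((S + (k₁ + kₘ) ∸ k₁) ∷ S ∷ R , (l ∷ D) ∷ʳ (l + last ((l ∷ D) ∷ʳ e)))
      ≡⟨ cong₂ (λ a b → just (a ∷ S ∷ R , (l ∷ D) ∷ʳ (l + b))) S+k₁+kₘ∸k₁ (last-∷ʳ e (l ∷ D)) ⟩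
    just ((S + kₘ) ∷ S ∷ R , (l ∷ D) ∷ʳ (l + e))
      ≡⟨ cong (λ a → just ((S + kₘ) ∷ S ∷ R , (l ∷ D) ∷ʳ a)) l+e≡d ⟩
    just ((S + kₘ) ∷ S ∷ R , (l ∷ D) ∷ʳ d)
      ≡⟨ cong just (cong₂ _,_ reverse-psum-k (reverse-diffs-∷ n₁ (n₂ ∷ ns))) ⟨
    just (conj (n₁ ∷ n₂ ∷ ns , k)) ∎
    where
    open ≡-Reasoning
    kₘ = last k
    S = last (psum (init k))
    R = reverse (init (psum (init k)))
    l = last (n₂ ∷ ns)
    d = n₁ ∸ n₂
    e = n₁ ∸ l ∸ n₂
    D = reverse (init (diffs (n₂ ∷ ns)))
    applicable′ : S + last (S ∷ R) < S + (k₁ + kₘ)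
    applicable′ = subst (λ z → S + z < S + (k₁ + kₘ)) (sym (last-reverse-init-psum (init k)))
                        (+-monoʳ-< S (m<m+n k₁ kₘ>0))
    reverse-psum-k : reverse (psum k) ≡ (S + kₘ) ∷ S ∷ R
    reverse-psum-k = trans (cong (λ v → reverse (psum v)) (sym (init-∷ʳ-last k))) (reverse-psum-∷ʳ (init k) kₘ)
    S+k₁+kₘ∸k₁ : S + (k₁ + kₘ) ∸ k₁ ≡ S + kₘ
    S+k₁+kₘ∸k₁ = trans (+-∸-assoc S (m≤m+n k₁ kₘ)) (cong (S +_) (m+n∸m≡n k₁ kₘ))
    l+e≡d : l + e ≡ d
    l+e≡d = begin
      l + (n₁ ∸ l ∸ n₂)   ≡⟨ cong (l +_) (trans (∸-+-assoc n₁ l n₂) (cong (n₁ ∸_) (+-comm l n₂))) ⟩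
      l + (n₁ ∸ (n₂ + l)) ≡⟨ cong (l +_) (∸-+-assoc n₁ n₂ l) ⟨
      l + (d ∸ l)         ≡⟨ m+[n∸m]≡n (m+n≤o⇒m≤o∸n l (subst (_≤ n₁) (+-comm n₂ l) (<⇒≤ applicable))) ⟩
      d                   ∎

Tt-conj : (i : Fin 2) (n k : Vec ℕ (suc (suc m))) {q : Part (suc (suc m))} →
  All (0 <_) k → Tt i (n , k) ≡ just q →
  All (0 <_) (proj₂ q) × Tt i (conj q) ≡ just (conj (n , k))
Tt-conj zero (n₁ ∷ n₂ ∷ ns) (k₁ ∷ k₂ ∷ ks) (k₁>0 ∷ k₂>0 ∷ ks>0) eq
  with T0-just n₁ n₂ ns k₁ k₂ ks eq
... | applicable , refl =
  (≤-trans k₂>0 (m≤n+m k₂ k₁) ∷ All-∷ʳ ks>0 k₁>0) , T0-conj n₁ n₂ ns k₁ k₂ ks applicable k₂>0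
Tt-conj (suc zero) (n₁ ∷ n₂ ∷ ns) k k>0 eq
  with T1-just n₁ n₂ ns k eq
... | applicable , refl =
  All-∷ʳ (All-init k>0) (≤-trans (All-last k>0) (m≤n+m (last k) (head k))) ,
  T1-conj n₁ n₂ ns k applicable (All-last k>0)

run-++ : (is js : List (Fin 2)) (p : Part (suc (suc m))) → run (is ++ js) p ≡ (run is p >>= run js)
run-++ List.[] js p = refl
run-++ (i List.∷ is) js p with Tt i p
... | just q = run-++ is js q
... | nothing = refl

run-reverse-conj : (is : List (Fin 2)) (n k : Vec ℕ (suc (suc m))) {r : Part (suc (suc m))} →
  All (0 <_) k → run is (n , k) ≡ just r → run (List.reverse is) (conj r) ≡ just (conj (n , k))
run-reverse-conj List.[] n k k>0 refl = refl
run-reverse-conj (i List.∷ is) n k {r} k>0 eq with Tt i (n , k) in step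
... | just (n′ , k′) with Tt-conj i n k k>0 step
...   | k′>0 , step⁻¹ = begin
  run (List.reverse (i List.∷ is)) (conj r)   ≡⟨ cong (λ js → run js (conj r)) (unfold-reverse i is) ⟩
  run (List.reverse is ++ [ i ]) (conj r)     ≡⟨ run-++ (List.reverse is) [ i ] (conj r) ⟩
  (run (List.reverse is) (conj r) >>= run [ i ]) ≡⟨ cong (_>>= run [ i ]) (run-reverse-conj is n′ k′ k′>0 eq) ⟩
  (Tt i (conj (n′ , k′)) >>= just)               ≡⟨ cong (_>>= just) step⁻¹ ⟩
  just (conj (n , k))                            ∎
  where open ≡-Reasoning

theorem5p5 : (m' : ℕ) (is : List (Fin 2)) (n k n̄ k̄ : Vec ℕ (suc (suc m'))) →
    IsPartition (n , k) →
    run is (n , k) ≡ just (n̄ , k̄) →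
    run (List.reverse is) (conj (n̄ , k̄)) ≡ just (conj (n , k))
theorem5p5 _ is n k _ _ (_ , k>0) = run-reverse-conj is n k k>0
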